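{- Let $G$ be a finite directed graph (multiple edges and loops allowed) with vertex set $V$ and edge set $E$, let $M$ be its signed incidence matrix, and let $\mathcal{M}=\mathcal{M}(G)$ be the graphical matroid represented by $M$. Let $H$ be a subgraph of $G$ and $\mathcal{N}$ the sub-matroid with base set $E(H)$. If the orientation of $\mathcal{N}$ induced from $M$ is coherent acyclic (in the matroid sense), then $H$ is a cut subgraph of $G$ and the orientation of $H$ induced by $G$ is coherent acyclic (in the graph sense).
   Context: The signed incidence matrix $M$ has rows indexed by $V$ and columns by $E$, with $M_{ve}=-1$ if $e$ points away from $v$, $+1$ if $e$ points towards $v$, and $0$ if $e$ is a loop or not incident to $v$. A subgraph is a subset of edges on the full vertex set. $H$ is a cut subgraph if there is an ordered partition $V=V_1\sqcup\dots\sqcup V_s$ such that $E(H)$ is exactly the set of edges of $G$ joining vertices in different parts; the orientation of $H$ is coherent acyclic (graph sense) if there is such a partition in which every edge $(u,v)$ of $H$ has $u\in V_i$, $v\in V_j$ with $i<j$. Let $\Gamma(\mathcal{M})=\operatorname{Row}(M)\cap\mathbb{Z}^E$. The orientation of $\mathcal{N}$ induced from $M$ is coherent acyclic (matroid sense) if for every $e\in E(H)$ there exists $z_e\in(\mathbb{Z}_{\ge0})^E$ supported on $E(H)$ with $e+z_e\in\Gamma(\mathcal{M})$, where $e$ also denotes the standard basis vector of $\mathbb{R}^E$. -}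

module Defs where

open import Data.Nat using (ℕ; zero; suc)
open import Data.Integer using (ℤ; +_; -[1+_])
open import Data.Rational using (ℚ; _/_; 0ℚ; _+_; _*_)
open import Data.Fin using (Fin; zero; suc; _<_)
open import Data.Fin.Properties using () renaming (_≟_ to _≟ᶠ_)
open import Data.Bool using (Bool; true; false; T)
open import Data.Product using (Σ; ∃; _×_)
open import Relation.Nullary using (¬_; yes; no)
open import Relation.Binary.PropositionalEquality using (_≡_; _≢_)
open import Function.Bundles using (_⇔_)

record Digraph (n m : ℕ) : Set where
  field
    src : Fin m → Fin n
    tgt : Fin m → Fin n
open Digraph public

incidence : ∀ {n m} → Digraph n m → Fin n → Fin m → ℤ
incidence G v e with src G e ≟ᶠ tgt G e
... | yes _ = + 0
... | no _ with v ≟ᶠ tgt G e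
...   | yes _ = + 1
...   | no _ with v ≟ᶠ src G e
...     | yes _ = -[1+ 0 ]
...     | no _ = + 0

sumℚ : ∀ {n} → (Fin n → ℚ) → ℚ
sumℚ {zero} f = 0ℚ
sumℚ {suc n} f = f zero + sumℚ (λ i → f (suc i))

ℤ→ℚ : ℤ → ℚ
ℤ→ℚ z = z / 1

-- Γ(𝓜) = Row(M) ∩ ℤ^E : integer vectors that are (rational) linear
-- combinations of the rows of M.
InΓ : ∀ {n m} → Digraph n m → (Fin m → ℤ) → Set
InΓ {n} G x = Σ (Fin n → ℚ) λ c →
  ∀ f → sumℚ (λ v → c v * ℤ→ℚ (incidence G v f)) ≡ ℤ→ℚ (x f)

-- Subgraph: a subset of edges (on the full vertex set).
Subgraph : ℕ → Set
Subgraph m = Fin m → Bool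

_∈E_ : ∀ {m} → Fin m → Subgraph m → Set
e ∈E H = T (H e)

basisPlus : ∀ {m} → Fin m → (Fin m → ℕ) → Fin m → ℤ
basisPlus e z f with e ≟ᶠ f
... | yes _ = + suc (z f)
... | no _ = + z f

MatroidCoherentAcyclic : ∀ {n m} → Digraph n m → Subgraph m → Set
MatroidCoherentAcyclic G H =
  ∀ e → e ∈E H →
    Σ (_ → ℕ) λ z → (∀ f → ¬ (f ∈E H) → z f ≡ 0) × InΓ G (basisPlus e z)

-- An ordered partition V = V_1 ⊔ ... ⊔ V_s, given by the part map p
-- (surjective: all parts nonempty).
record OrderedPartition (n : ℕ) : Set where
  field
    s    : ℕ
    part : Fin n → Fin s
    surj : ∀ (i : Fin s) → ∃ λ v → part v ≡ i
open OrderedPartition public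

CutBy : ∀ {n m} → Digraph n m → Subgraph m → OrderedPartition n → Set
CutBy G H P = ∀ e → (e ∈E H) ⇔ (part P (src G e) ≢ part P (tgt G e))

IsCutSubgraph : ∀ {n m} → Digraph n m → Subgraph m → Set
IsCutSubgraph {n} G H = Σ (OrderedPartition n) λ P → CutBy G H P

GraphCoherentAcyclicCut : ∀ {n m} → Digraph n m → Subgraph m → Set
GraphCoherentAcyclicCut {n} G H = Σ (OrderedPartition n) λ P →
  CutBy G H P × (∀ e → e ∈E H → part P (src G e) < part P (tgt G e))

-- For each edge e of H the hypothesis gives a potential c on the vertices
-- whose coboundary f ↦ c (tgt f) - c (src f) is e + z_e: non-negative on
-- every edge, zero outside H and positive on e. The sum of these potentials
-- over all edges of H is constant along the edges outside H and strictly
-- increasing along the edges of H, so grouping the vertices by the rank of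
-- their potential gives an ordered partition whose cut is exactly E(H), with
-- every edge of H pointing forward.
module Submission where

open import Data.Nat using (ℕ)
open import Defs

open import Data.Bool using (Bool; true; false; T; if_then_else_)
open import Data.Bool.Properties using (T?; T-≡)
open import Data.Empty using (⊥-elim)
open import Data.Fin using (Fin; zero; suc; toℕ; fromℕ<)
import Data.Fin as Fin
open import Data.Fin.Properties using (_≟_; any?; suc-injective; toℕ-injective; toℕ-fromℕ<; toℕ<n; <⇒≢)
open import Data.Fin.Subset using (Subset; ∣_∣; _∈_; _⊂_)
open import Data.Fin.Subset.Properties using (∣p∣≤n; p⊂q⇒∣p∣<∣q∣)
open import Data.Integer using (+_; -[1+_])
import Data.Nat as ℕ
import Data.Nat.Properties as ℕ
open import Data.Product using (Σ; ∃; _×_; _,_; proj₁; proj₂)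
open import Data.Sum using (inj₁; inj₂)
open import Data.Rational using (ℚ; 0ℚ; _+_; _*_; -_; _≤_; _<_)
open import Data.Rational.Properties
  using (+-identityʳ; +-identityˡ; +-comm; *-zeroʳ; *-identityʳ; neg-distribʳ-*;
         +-monoʳ-≤; +-monoʳ-<; +-mono-≤; +-mono-<-≤; +-mono-≤-<;
         ≤-refl; ≤-reflexive; <-irrefl; <-trans; _<?_;
         nonNegative⁻¹; positive⁻¹; normalize-nonNeg; normalize-pos; +-0-group)
open import Data.Vec using (tabulate)
open import Data.Vec.Properties using (lookup∘tabulate; []=⇒lookup; lookup⇒[]=)
open import Function using (_∘_; Equivalence; mk⇔)
open import Relation.Binary using (Decidable; Transitive; Irreflexive)
open import Relation.Binary.PropositionalEquality
open import Relation.Nullary using (¬_; yes; no)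
open import Relation.Nullary.Decidable using (⌊_⌋; toWitness; fromWitness; decidable-stable)

open import Algebra.Properties.Group +-0-group using (\\-leftDividesˡ)

sumℚ-cong : ∀ {n} {g h : Fin n → ℚ} → (∀ v → g v ≡ h v) → sumℚ g ≡ sumℚ h
sumℚ-cong {ℕ.zero}  _   = refl
sumℚ-cong {ℕ.suc n} g≗h = cong₂ _+_ (g≗h zero) (sumℚ-cong (g≗h ∘ suc))

sumℚ-zero : ∀ {n} (g : Fin n → ℚ) → (∀ v → g v ≡ 0ℚ) → sumℚ g ≡ 0ℚ
sumℚ-zero {ℕ.zero}  g _   = refl
sumℚ-zero {ℕ.suc n} g g≡0 = cong₂ _+_ (g≡0 zero) (sumℚ-zero (g ∘ suc) (g≡0 ∘ suc))

sumℚ-supportedAt : ∀ {n} (g : Fin n → ℚ) t → (∀ v → v ≢ t → g v ≡ 0ℚ) → sumℚ g ≡ g t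
sumℚ-supportedAt {ℕ.suc n} g zero g≡0 = begin
  g zero + sumℚ (g ∘ suc) ≡⟨ cong (_+_ (g zero)) (sumℚ-zero (g ∘ suc) (λ v → g≡0 (suc v) λ ())) ⟩
  g zero + 0ℚ             ≡⟨ +-identityʳ (g zero) ⟩
  g zero                  ∎
  where open ≡-Reasoning
sumℚ-supportedAt {ℕ.suc n} g (suc t) g≡0 = begin
  g zero + sumℚ (g ∘ suc) ≡⟨ cong₂ _+_ (g≡0 zero λ ()) (sumℚ-supportedAt (g ∘ suc) t λ v v≢t → g≡0 (suc v) (v≢t ∘ suc-injective)) ⟩
  0ℚ + g (suc t)          ≡⟨ +-identityˡ (g (suc t)) ⟩
  g (suc t)               ∎
  where open ≡-Reasoning

sumℚ-supportedAtPair : ∀ {n} (g : Fin n → ℚ) {s t} → s ≢ t →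
  (∀ v → v ≢ s → v ≢ t → g v ≡ 0ℚ) → sumℚ g ≡ g s + g t
sumℚ-supportedAtPair g {zero} {zero} s≢t _ = ⊥-elim (s≢t refl)
sumℚ-supportedAtPair g {zero} {suc t} _ g≡0 =
  cong (_+_ (g zero)) (sumℚ-supportedAt (g ∘ suc) t λ v v≢t → g≡0 (suc v) (λ ()) (v≢t ∘ suc-injective))
sumℚ-supportedAtPair g {suc s} {zero} _ g≡0 =
  trans (cong (_+_ (g zero)) (sumℚ-supportedAt (g ∘ suc) s λ v v≢s → g≡0 (suc v) (v≢s ∘ suc-injective) (λ ())))
        (+-comm (g zero) (g (suc s)))
sumℚ-supportedAtPair g {suc s} {suc t} s≢t g≡0 =
  trans (cong₂ _+_ (g≡0 zero (λ ()) (λ ()))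
                   (sumℚ-supportedAtPair (g ∘ suc) (s≢t ∘ cong suc)
                     λ v v≢s v≢t → g≡0 (suc v) (v≢s ∘ suc-injective) (v≢t ∘ suc-injective)))
        (+-identityˡ (g (suc s) + g (suc t)))

sumℚ-mono-≤ : ∀ {n} {g h : Fin n → ℚ} → (∀ v → g v ≤ h v) → sumℚ g ≤ sumℚ h
sumℚ-mono-≤ {ℕ.zero}  _   = ≤-refl
sumℚ-mono-≤ {ℕ.suc n} g≤h = +-mono-≤ (g≤h zero) (sumℚ-mono-≤ (g≤h ∘ suc))

sumℚ-mono-< : ∀ {n} {g h : Fin n → ℚ} → (∀ v → g v ≤ h v) → ∀ t → g t < h t → sumℚ g < sumℚ h
sumℚ-mono-< {ℕ.suc n} g≤h zero    gt<ht = +-mono-<-≤ gt<ht (sumℚ-mono-≤ (g≤h ∘ suc))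
sumℚ-mono-< {ℕ.suc n} g≤h (suc t) gt<ht = +-mono-≤-< (g≤h zero) (sumℚ-mono-< (g≤h ∘ suc) t gt<ht)

module _ {n m} (G : Digraph n m) where

  incidence-loop : ∀ {v f} → src G f ≡ tgt G f → incidence G v f ≡ + 0
  incidence-loop {v} {f} loop with src G f ≟ tgt G f
  ... | yes _      = refl
  ... | no nonloop = ⊥-elim (nonloop loop)

  incidence-tgt : ∀ {f} → src G f ≢ tgt G f → incidence G (tgt G f) f ≡ + 1
  incidence-tgt {f} nonloop with src G f ≟ tgt G f
  ... | yes loop = ⊥-elim (nonloop loop)
  ... | no _ with tgt G f ≟ tgt G f
  ...   | yes _   = refl
  ...   | no t≢t  = ⊥-elim (t≢t refl)

  incidence-src : ∀ {f} → src G f ≢ tgt G f → incidence G (src G f) f ≡ -[1+ 0 ]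
  incidence-src {f} nonloop with src G f ≟ tgt G f
  ... | yes loop = ⊥-elim (nonloop loop)
  ... | no _ with src G f ≟ tgt G f
  ...   | yes loop = ⊥-elim (nonloop loop)
  ...   | no _ with src G f ≟ src G f
  ...     | yes _  = refl
  ...     | no s≢s = ⊥-elim (s≢s refl)

  incidence-nonincident : ∀ {v f} → v ≢ src G f → v ≢ tgt G f → incidence G v f ≡ + 0
  incidence-nonincident {v} {f} v≢s v≢t with src G f ≟ tgt G f
  ... | yes _ = refl
  ... | no _ with v ≟ tgt G f
  ...   | yes v≡t = ⊥-elim (v≢t v≡t)
  ...   | no _ with v ≟ src G f
  ...     | yes v≡s = ⊥-elim (v≢s v≡s)
  ...     | no _    = refl

  coboundary : (Fin n → ℚ) → Fin m → ℚ
  coboundary c f = sumℚ (λ v → c v * ℤ→ℚ (incidence G v f))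

  coboundary-loop : ∀ c {f} → src G f ≡ tgt G f → coboundary c f ≡ 0ℚ
  coboundary-loop c loop =
    sumℚ-zero _ λ v → trans (cong (λ i → c v * ℤ→ℚ i) (incidence-loop loop)) (*-zeroʳ (c v))

  coboundary-nonloop : ∀ c {f} → src G f ≢ tgt G f → c (src G f) + coboundary c f ≡ c (tgt G f)
  coboundary-nonloop c {f} nonloop = begin
    c x + coboundary c f
      ≡⟨ cong (_+_ (c x)) (sumℚ-supportedAtPair _ nonloop λ v v≢s v≢t →
           trans (cong (λ i → c v * ℤ→ℚ i) (incidence-nonincident v≢s v≢t)) (*-zeroʳ (c v))) ⟩
    c x + (c x * ℤ→ℚ (incidence G x f) + c y * ℤ→ℚ (incidence G y f))
      ≡⟨ cong (_+_ (c x)) (cong₂ _+_ (cong (λ i → c x * ℤ→ℚ i) (incidence-src nonloop))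
                                     (cong (λ i → c y * ℤ→ℚ i) (incidence-tgt nonloop))) ⟩
    c x + (c x * ℤ→ℚ -[1+ 0 ] + c y * ℤ→ℚ (+ 1))
      ≡⟨ cong (_+_ (c x)) (cong₂ _+_ (trans (sym (neg-distribʳ-* (c x) _)) (cong -_ (*-identityʳ (c x))))
                                     (*-identityʳ (c y))) ⟩
    c x + (- c x + c y)
      ≡⟨ \\-leftDividesˡ (c x) (c y) ⟩
    c y ∎
    where
    open ≡-Reasoning
    x y : Fin n
    x = src G f
    y = tgt G f

ℤ→ℚ-nonNeg : ∀ k → 0ℚ ≤ ℤ→ℚ (+ k)
ℤ→ℚ-nonNeg k = nonNegative⁻¹ _ {{normalize-nonNeg k 1}}

ℤ→ℚ-pos : ∀ k → 0ℚ < ℤ→ℚ (+ ℕ.suc k)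
ℤ→ℚ-pos k = positive⁻¹ _ {{normalize-pos (ℕ.suc k) 1}}

module _ {m} (e : Fin m) (z : Fin m → ℕ) where

  basisPlus-nonNeg : ∀ f → 0ℚ ≤ ℤ→ℚ (basisPlus e z f)
  basisPlus-nonNeg f with e ≟ f
  ... | yes _ = ℤ→ℚ-nonNeg (ℕ.suc (z f))
  ... | no _  = ℤ→ℚ-nonNeg (z f)

  basisPlus-pos : 0ℚ < ℤ→ℚ (basisPlus e z e)
  basisPlus-pos with e ≟ e
  ... | yes _ = ℤ→ℚ-pos (z e)
  ... | no e≢e = ⊥-elim (e≢e refl)

  basisPlus-zero : ∀ {f} → e ≢ f → z f ≡ 0 → basisPlus e z f ≡ + 0
  basisPlus-zero {f} e≢f zf≡0 with e ≟ f
  ... | yes e≡f = ⊥-elim (e≢f e≡f)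
  ... | no _    = cong +_ zf≡0

record AscendingPotential {n m} (G : Digraph n m) (H : Subgraph m) (c : Fin n → ℚ) : Set where
  field
    ascending    : ∀ f → c (src G f) ≤ c (tgt G f)
    levelOutside : ∀ f → ¬ f ∈E H → c (src G f) ≡ c (tgt G f)

module _ {n m} (G : Digraph n m) (H : Subgraph m) where

  certificate⇒potential : ∀ {e} → e ∈E H →
    Σ (Fin m → ℕ) (λ z → (∀ f → ¬ (f ∈E H) → z f ≡ 0) × InΓ G (basisPlus e z)) →
    Σ (Fin n → ℚ) λ c → AscendingPotential G H c × c (src G e) < c (tgt G e)
  certificate⇒potential {e} e∈H (z , z-outside , c , δc≡e+z) =
    c , record { ascending = ascending ; levelOutside = levelOutside } , strict
    where
    along : ∀ f → src G f ≢ tgt G f → c (src G f) + ℤ→ℚ (basisPlus e z f) ≡ c (tgt G f)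
    along f nonloop = trans (cong (_+_ (c (src G f))) (sym (δc≡e+z f))) (coboundary-nonloop G c nonloop)

    ascending : ∀ f → c (src G f) ≤ c (tgt G f)
    ascending f with src G f ≟ tgt G f
    ... | yes loop    = ≤-reflexive (cong c loop)
    ... | no nonloop  =
      subst₂ _≤_ (+-identityʳ _) (along f nonloop) (+-monoʳ-≤ (c (src G f)) (basisPlus-nonNeg e z f))

    levelOutside : ∀ f → ¬ f ∈E H → c (src G f) ≡ c (tgt G f)
    levelOutside f f∉H with src G f ≟ tgt G f
    ... | yes loop    = cong c loop
    ... | no nonloop  = begin
      c (src G f)                                ≡⟨ +-identityʳ (c (src G f)) ⟨
      c (src G f) + ℤ→ℚ (+ 0)                    ≡⟨ cong (λ i → c (src G f) + ℤ→ℚ i) (basisPlus-zero e z e≢f (z-outside f f∉H)) ⟨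
      c (src G f) + ℤ→ℚ (basisPlus e z f)        ≡⟨ along f nonloop ⟩
      c (tgt G f)                                ∎
      where
      open ≡-Reasoning
      e≢f : e ≢ f
      e≢f refl = f∉H e∈H

    e-nonloop : src G e ≢ tgt G e
    e-nonloop loop =
      <-irrefl refl (subst (0ℚ <_) (trans (sym (δc≡e+z e)) (coboundary-loop G c loop)) (basisPlus-pos e z))

    strict : c (src G e) < c (tgt G e)
    strict = subst₂ _<_ (+-identityʳ _) (along e e-nonloop) (+-monoʳ-< (c (src G e)) (basisPlus-pos e z))

  edgePotential : MatroidCoherentAcyclic G H → ∀ e →
    Σ (Fin n → ℚ) λ c → AscendingPotential G H c × (e ∈E H → c (src G e) < c (tgt G e))
  edgePotential hyp e with T? (H e)
  ... | yes e∈H =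
    let c , ascendingPotential , strict = certificate⇒potential e∈H (hyp e e∈H)
    in  c , ascendingPotential , λ _ → strict
  ... | no e∉H =
    (λ _ → 0ℚ) , record { ascending = λ _ → ≤-refl ; levelOutside = λ _ _ → refl } , ⊥-elim ∘ e∉H

record SeparatingPotential {n m} (G : Digraph n m) (H : Subgraph m) : Set where
  field
    potential        : Fin n → ℚ
    levelOutside     : ∀ f → ¬ f ∈E H → potential (src G f) ≡ potential (tgt G f)
    increasingInside : ∀ f → f ∈E H → potential (src G f) < potential (tgt G f)

separatingPotential : ∀ {n m} (G : Digraph n m) (H : Subgraph m) →
  MatroidCoherentAcyclic G H → SeparatingPotential G H
separatingPotential {n} {m} G H hyp = record
  { potential        = λ v → sumℚ (λ e → c e v)
  ; levelOutside     = λ f f∉H → sumℚ-cong λ e → AscendingPotential.levelOutside (ascendingPotential e) f f∉H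
  ; increasingInside = λ f f∈H → sumℚ-mono-< (λ e → AscendingPotential.ascending (ascendingPotential e) f) f (strictAt f f∈H)
  }
  where
  c : Fin m → Fin n → ℚ
  c e = proj₁ (edgePotential G H hyp e)

  ascendingPotential : ∀ e → AscendingPotential G H (c e)
  ascendingPotential e = proj₁ (proj₂ (edgePotential G H hyp e))

  strictAt : ∀ e → e ∈E H → c e (src G e) < c e (tgt G e)
  strictAt e = proj₂ (proj₂ (edgePotential G H hyp e))

record OrderedPartitionBy {n} {A : Set} (_≺_ : A → A → Set) (c : Fin n → A) : Set where
  field
    partition : OrderedPartition n
    part-cong : ∀ {u v} → c u ≡ c v → part partition u ≡ part partition v
    part-mono : ∀ {u v} → c u ≺ c v → part partition u Fin.< part partition v

countBelow : (ℕ → Bool) → ℕ → ℕ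
countBelow P ℕ.zero    = 0
countBelow P (ℕ.suc b) = if P b then ℕ.suc (countBelow P b) else countBelow P b

module _ (P : ℕ → Bool) where

  countBelow-≤-suc : ∀ b → countBelow P b ℕ.≤ countBelow P (ℕ.suc b)
  countBelow-≤-suc b with P b
  ... | true  = ℕ.n≤1+n _
  ... | false = ℕ.≤-refl

  countBelow-mono-≤ : ∀ {a b} → a ℕ.≤′ b → countBelow P a ℕ.≤ countBelow P b
  countBelow-mono-≤ ℕ.≤′-refl          = ℕ.≤-refl
  countBelow-mono-≤ (ℕ.≤′-step a≤′b) = ℕ.≤-trans (countBelow-mono-≤ a≤′b) (countBelow-≤-suc _)

  countBelow-mono-< : ∀ {a b} → T (P a) → a ℕ.< b → countBelow P a ℕ.< countBelow P b
  countBelow-mono-< {a} Pa a<b = ℕ.≤-trans (counted Pa) (countBelow-mono-≤ (ℕ.≤⇒≤′ a<b))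
    where
    counted : T (P a) → ℕ.suc (countBelow P a) ℕ.≤ countBelow P (ℕ.suc a)
    counted Pa with P a
    ... | true = ℕ.≤-refl

  countBelow-surjective : ∀ b {i} → i ℕ.< countBelow P b → ∃ λ k → T (P k) × countBelow P k ≡ i
  countBelow-surjective (ℕ.suc b) i< with P b in Pb≡true
  ... | false = countBelow-surjective b i<
  ... | true with ℕ.m<1+n⇒m<n∨m≡n i<
  ...   | inj₁ i<′ = countBelow-surjective b i<′
  ...   | inj₂ refl = b , Equivalence.from T-≡ Pb≡true , refl

-- The part of v is the number of values of k smaller than k v.
orderedPartitionByℕ : ∀ {n} (k : Fin n → ℕ) {B} → (∀ v → k v ℕ.< B) → OrderedPartitionBy ℕ._<_ k
orderedPartitionByℕ {n} k {B} k<B = record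
  { partition = record { s = countBelow inImage B ; part = denseRank ; surj = denseRank-surjective }
  ; part-cong = λ {u} {v} ku≡kv → toℕ-injective (begin
      toℕ (denseRank u)          ≡⟨ toℕ-denseRank u ⟩
      countBelow inImage (k u)   ≡⟨ cong (countBelow inImage) ku≡kv ⟩
      countBelow inImage (k v)   ≡⟨ toℕ-denseRank v ⟨
      toℕ (denseRank v)          ∎)
  ; part-mono = λ {u} {v} ku<kv →
      subst₂ ℕ._<_ (sym (toℕ-denseRank u)) (sym (toℕ-denseRank v))
        (countBelow-mono-< inImage (inImage-k u) ku<kv)
  }
  where
  open ≡-Reasoning

  inImage : ℕ → Bool
  inImage j = ⌊ any? (λ w → k w ℕ.≟ j) ⌋

  inImage-k : ∀ v → T (inImage (k v))
  inImage-k v = fromWitness (v , refl)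

  denseRank : Fin n → Fin (countBelow inImage B)
  denseRank v = fromℕ< (countBelow-mono-< inImage (inImage-k v) (k<B v))

  toℕ-denseRank : ∀ v → toℕ (denseRank v) ≡ countBelow inImage (k v)
  toℕ-denseRank v = toℕ-fromℕ< _

  denseRank-surjective : ∀ i → ∃ λ v → denseRank v ≡ i
  denseRank-surjective i with countBelow-surjective inImage B (toℕ<n i)
  ... | j , j∈image , rank≡i with toWitness j∈image
  ...   | v , kv≡j = v , toℕ-injective (trans (toℕ-denseRank v) (trans (cong (countBelow inImage) kv≡j) rank≡i))

module _ {A : Set} {_≺_ : A → A → Set}
         (≺-trans : Transitive _≺_) (≺-irrefl : Irreflexive _≡_ _≺_) (_≺?_ : Decidable _≺_)
         {n} (c : Fin n → A) where

  below : A → Subset n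
  below a = tabulate (λ w → ⌊ c w ≺? a ⌋)

  ∈-below⁺ : ∀ {w a} → c w ≺ a → w ∈ below a
  ∈-below⁺ {w} {a} cw≺a =
    lookup⇒[]= w (below a) (trans (lookup∘tabulate _ w) (Equivalence.to T-≡ (fromWitness cw≺a)))

  ∈-below⁻ : ∀ {w a} → w ∈ below a → c w ≺ a
  ∈-below⁻ {w} {a} w∈below =
    toWitness (Equivalence.from T-≡ (trans (sym (lookup∘tabulate _ w)) ([]=⇒lookup w∈below)))

  below-⊂ : ∀ {u v} → c u ≺ c v → below (c u) ⊂ below (c v)
  below-⊂ {u} cu≺cv =
    (λ w∈ → ∈-below⁺ (≺-trans (∈-below⁻ w∈) cu≺cv)) , u , ∈-below⁺ cu≺cv , ≺-irrefl refl ∘ ∈-below⁻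

  rank : Fin n → ℕ
  rank v = ∣ below (c v) ∣

  orderedPartitionBy : OrderedPartitionBy _≺_ c
  orderedPartitionBy = record
    { partition = partition
    ; part-cong = part-cong ∘ cong (λ a → ∣ below a ∣)
    ; part-mono = part-mono ∘ p⊂q⇒∣p∣<∣q∣ ∘ below-⊂
    }
    where open OrderedPartitionBy (orderedPartitionByℕ rank (λ v → ℕ.s≤s (∣p∣≤n (below (c v)))))

proposition5p6 : ∀ {n m : ℕ} (G : Digraph n m) (H : Subgraph m) →
    MatroidCoherentAcyclic G H → GraphCoherentAcyclicCut G H
proposition5p6 G H hyp = partition , cut , forward
  where
  open SeparatingPotential (separatingPotential G H hyp)
  open OrderedPartitionBy (orderedPartitionBy <-trans <-irrefl _<?_ potential)

  forward : ∀ e → e ∈E H → part partition (src G e) Fin.< part partition (tgt G e)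
  forward e = part-mono ∘ increasingInside e

  cut : CutBy G H partition
  cut e = mk⇔ (<⇒≢ ∘ forward e)
              (λ parts≢ → decidable-stable (T? (H e)) (parts≢ ∘ part-cong ∘ levelOutside e))
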